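{- Let $n,k$ be integers with $n\geq 5$ and $1\leq k\leq n$, and let $f_v(n,k)$ be the minimum integer such that every (connected) graph $G$ of order $n$ with $|E(G)|\geq f_v(n,k)$ satisfies $mvd(G)\geq k$. Then $f_v(n,k)=n-1$ if $k=1$; $f_v(n,k)=\frac{n(n-1)}{2}-1$ if $2\leq k\leq 3$; and $f_v(n,k)=\frac{n(n-1)}{2}$ if $4\leq k\leq n$.
   Context: All graphs are finite, simple, undirected and connected. For a vertex-colored graph and two nonadjacent vertices $x,y$, an $x$-$y$ vertex cut is a set $S\subseteq V(G)\setminus\{x,y\}$ such that $x$ and $y$ lie in different components of $G-S$; it is monochromatic if all its vertices have the same color. A vertex-coloring is an MVD-coloring if every pair of nonadjacent vertices has a monochromatic vertex cut separating them. $mvd(G)$ is the maximum number of colors used by an MVD-coloring of $G$. -}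

module Defs where

open import Data.Nat using (ℕ; zero; suc; _+_; _*_; _∸_; _≤_; _<?_)
open import Data.Nat.DivMod using (_/_)
open import Data.Bool using (Bool; true; false; _∧_; if_then_else_)
open import Data.Fin using (Fin; toℕ)
open import Data.List using (List; map; allFin; cartesianProduct)
open import Data.Nat.ListAction using (sum)
open import Data.Product using (Σ; ∃; _×_; _,_)
open import Relation.Nullary using (¬_; ⌊_⌋)
open import Relation.Binary.PropositionalEquality using (_≡_; _≢_)

record Graph (n : ℕ) : Set where
  field
    adj    : Fin n → Fin n → Bool
    sym    : ∀ i j → adj i j ≡ adj j i
    irrefl : ∀ i → adj i i ≡ false
open Graph public

edgeCount : ∀ {n} → Graph n → ℕ
edgeCount {n} G =
  sum (map (λ p → count (Data.Product.proj₁ p) (Data.Product.proj₂ p))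
           (cartesianProduct (allFin n) (allFin n)))
  where
  count : Fin n → Fin n → ℕ
  count i j = if ⌊ toℕ i <? toℕ j ⌋ ∧ adj G i j then 1 else 0

-- Vertex sets are represented by characteristic functions Fin n → Bool.
-- Reach G S x y : y is reachable from x in G - S (x, y both outside S).
data Reach {n : ℕ} (G : Graph n) (S : Fin n → Bool) : Fin n → Fin n → Set where
  here : ∀ {x} → S x ≡ false → Reach G S x x
  step : ∀ {x y z} → Reach G S x y → adj G y z ≡ true → S z ≡ false → Reach G S x z

Connected : ∀ {n} → Graph n → Set
Connected G = ∀ x y → Reach G (λ _ → false) x y

IsVertexCut : ∀ {n} → Graph n → (Fin n → Bool) → Fin n → Fin n → Set
IsVertexCut G S x y = S x ≡ false × S y ≡ false × ¬ Reach G S x y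

Monochromatic : ∀ {n c} → (Fin n → Fin c) → (Fin n → Bool) → Set
Monochromatic col S = ∀ u v → S u ≡ true → S v ≡ true → col u ≡ col v

IsMVDColoring : ∀ {n c} → Graph n → (Fin n → Fin c) → Set
IsMVDColoring {n} G col =
  ∀ (x y : Fin n) → x ≢ y → adj G x y ≡ false →
    ∃ λ (S : Fin n → Bool) → IsVertexCut G S x y × Monochromatic col S

-- A colouring uses exactly c colours when it is a surjection onto Fin c.
Surj : ∀ {n c} → (Fin n → Fin c) → Set
Surj {n} {c} col = ∀ (j : Fin c) → ∃ λ (i : Fin n) → col i ≡ j

-- mvd(G) ≥ k : some MVD-colouring of G uses c ≥ k colours
-- (mvd(G) is the maximum of the number of colours used by MVD-colourings).
MvdAtLeast : ∀ {n} → Graph n → ℕ → Set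
MvdAtLeast {n} G k =
  ∃ λ (c : ℕ) → k ≤ c × Σ (Fin n → Fin c) (λ col → Surj col × IsMVDColoring G col)

EdgeForcesMvd : ℕ → ℕ → ℕ → Set
EdgeForcesMvd n k m = ∀ (G : Graph n) → Connected G → m ≤ edgeCount G → MvdAtLeast G k

-- m = f_v(n,k): m is the least value (among the possible edge numbers m ≥ n-1 of a
-- connected graph of order n) with property EdgeForcesMvd n k.
IsFv : ℕ → ℕ → ℕ → Set
IsFv n k m =
  n ∸ 1 ≤ m × EdgeForcesMvd n k m ×
  (∀ m′ → n ∸ 1 ≤ m′ → EdgeForcesMvd n k m′ → m ≤ m′)

choose2 : ℕ → ℕ
choose2 n = n * (n ∸ 1) / 2

-- |E(G)| plus the number of non-adjacent pairs is n(n−1)/2. With n(n−1)/2 edges G is complete,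
-- so the identity colouring is (vacuously) an MVD-colouring. With one edge fewer G has at most one
-- non-edge x₀y₀; colouring x₀, y₀ and all other vertices with three colours makes V ∖ {x₀, y₀} a
-- monochromatic cut. Sharpness: in Kₙ − 01 every 0–1 cut contains all other vertices, so at most
-- three colours occur; in Kₙ − {01, 23} the 0–1 and 2–3 cuts cover V and share the vertex 4, so only
-- one colour occurs. For k = 1 a constant colouring always works.
module Submission where

open import Defs
open import Data.Nat using (ℕ; _≤_; _∸_)
open import Data.Product using (_×_)
open import Relation.Binary.PropositionalEquality using (_≡_)

open import Data.Nat using (zero; suc; _+_; _*_; _<_; _<?_; z≤n; s≤s)
open import Data.Nat.Properties
  using ( +-0-commutativeMonoid; ≤-refl; ≤-reflexive; ≤-trans; +-mono-≤; +-monoʳ-≤; +-comm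
        ; +-cancelˡ-≤; m≤m+n; m≤n+m; m≤n+m∸n; m+n∸n≡m; ∸-monoʳ-≤; ∸-monoˡ-≤; m∸n≤m
        ; <-cmp; <-irrefl; <-asym; <⇒≱; ≮⇒≥; <⇒≤pred; pred[m∸n]≡m∸[1+n]; n<1+n; module ≤-Reasoning)
open import Data.Nat.DivMod using (_/_; m*n/n≡m; +-distrib-/-∣ˡ)
open import Data.Nat.Divisibility using (divides)
open import Data.Nat.ListAction using (sum)
open import Data.Nat.ListAction.Properties using (sum-++)
open import Data.Nat.Tactic.RingSolver using (solve-∀)
open import Algebra.Properties.CommutativeMonoid.Sum +-0-commutativeMonoid
  using (sum-syntax; sum-cong-≗; ∑-distrib-+; sum-replicate-zero)
open import Data.Bool using (Bool; true; false; not; _∧_; _∨_; if_then_else_)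
open import Data.Bool.Properties using (∨-comm; ∧-zeroʳ; ¬-not) renaming (_≟_ to _≟ᵇ_)
open import Data.Fin using (Fin; zero; suc; toℕ)
open import Data.Fin.Patterns using (0F; 1F; 2F; 3F; 4F)
open import Data.Fin.Properties using (_≟_; toℕ-injective; injective⇒≤; any?)
open import Data.List using (List; []; _∷_; _++_; map; tabulate; allFin; cartesianProduct; length)
open import Data.List.Properties using (map-++; map-∘)
open import Data.List.Relation.Unary.All using (All; []; _∷_)
open import Data.Product using (∃; ∃₂; _,_; proj₁; proj₂)
open import Data.Sum using (_⊎_; inj₁; inj₂)
open import Function using (_∘_; id)
open import Relation.Binary using (tri<; tri≈; tri>)
open import Relation.Binary.PropositionalEquality as ≡ using (refl; trans; cong; cong₂; _≢_)
open import Relation.Nullary using (¬_; yes; no; does; contradiction)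
open import Relation.Nullary.Decidable using (isYes; isYes≗does; dec-true; dec-false; _×-dec_; ¬?)

𝟙 : Bool → ℕ
𝟙 b = if b then 1 else 0

𝟙≤1 : ∀ b → 𝟙 b ≤ 1
𝟙≤1 true  = ≤-refl
𝟙≤1 false = z≤n

𝟙-∨ : ∀ a b → 𝟙 (a ∨ b) ≤ 𝟙 a + 𝟙 b
𝟙-∨ true  b = s≤s z≤n
𝟙-∨ false b = ≤-refl

𝟙-∧-split : ∀ a b → 𝟙 (a ∧ b) + 𝟙 (a ∧ not b) ≡ 𝟙 a
𝟙-∧-split true  true  = refl
𝟙-∧-split true  false = refl
𝟙-∧-split false b     = refl

∑-mono-≤ : ∀ {n} {f g : Fin n → ℕ} → (∀ i → f i ≤ g i) → ∑[ i < n ] f i ≤ ∑[ i < n ] g i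
∑-mono-≤ {zero}  f≤g = z≤n
∑-mono-≤ {suc n} f≤g = +-mono-≤ (f≤g 0F) (∑-mono-≤ (f≤g ∘ suc))

∑-ones : ∀ n → ∑[ i < n ] 1 ≡ n
∑-ones zero    = refl
∑-ones (suc n) = cong suc (∑-ones n)

term≤∑ : ∀ {n} (f : Fin n → ℕ) i → f i ≤ ∑[ j < n ] f j
term≤∑ f 0F      = m≤m+n _ _
term≤∑ f (suc i) = ≤-trans (term≤∑ (f ∘ suc) i) (m≤n+m _ (f 0F))

two-terms≤∑ : ∀ {n} (f : Fin n → ℕ) {i j} → i ≢ j → f i + f j ≤ ∑[ k < n ] f k
two-terms≤∑ f {0F}    {0F}    i≢j = contradiction refl i≢j
two-terms≤∑ f {0F}    {suc j} _   = +-monoʳ-≤ (f 0F) (term≤∑ (f ∘ suc) j)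
two-terms≤∑ f {suc i} {0F}    _   =
  ≤-trans (≤-reflexive (+-comm (f (suc i)) (f 0F))) (+-monoʳ-≤ (f 0F) (term≤∑ (f ∘ suc) i))
two-terms≤∑ f {suc i} {suc j} i≢j =
  ≤-trans (two-terms≤∑ (f ∘ suc) (i≢j ∘ cong suc)) (m≤n+m _ (f 0F))

∑≤1-unique : ∀ {n} (f : Fin n → ℕ) {i j} → ∑[ k < n ] f k ≤ 1 → 1 ≤ f i → 1 ≤ f j → i ≡ j
∑≤1-unique f {i} {j} ∑≤1 1≤fi 1≤fj with i ≟ j
... | yes i≡j = i≡j
... | no  i≢j =
  contradiction (≤-trans (+-mono-≤ 1≤fi 1≤fj) (≤-trans (two-terms≤∑ f i≢j) ∑≤1)) λ { (s≤s ()) }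

∑∑-distrib-+ : ∀ {n} (f g : Fin n → Fin n → ℕ) →
  ∑[ i < n ] ∑[ j < n ] (f i j + g i j) ≡ ∑[ i < n ] ∑[ j < n ] f i j + ∑[ i < n ] ∑[ j < n ] g i j
∑∑-distrib-+ {n} f g =
  trans (sum-cong-≗ (λ i → ∑-distrib-+ (f i) (g i))) (∑-distrib-+ (λ i → ∑[ j < n ] f i j) _)

term≤∑∑ : ∀ {n} (h : Fin n → Fin n → ℕ) i j → h i j ≤ ∑[ a < n ] ∑[ b < n ] h a b
term≤∑∑ {n} h i j = ≤-trans (term≤∑ (h i) j) (term≤∑ (λ a → ∑[ b < n ] h a b) i)

∑∑≤1-unique : ∀ {n} (h : Fin n → Fin n → ℕ) {i j i′ j′} → ∑[ a < n ] ∑[ b < n ] h a b ≤ 1 →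
  1 ≤ h i j → 1 ≤ h i′ j′ → i ≡ i′ × j ≡ j′
∑∑≤1-unique {n} h {i} {j} {i′} {j′} ∑∑≤1 1≤hij 1≤hi′j′
  with ∑≤1-unique (λ a → ∑[ b < n ] h a b) ∑∑≤1
                  (≤-trans 1≤hij (term≤∑ (h i) j)) (≤-trans 1≤hi′j′ (term≤∑ (h i′) j′))
... | refl = refl , ∑≤1-unique (h i) (≤-trans (term≤∑ (λ a → ∑[ b < n ] h a b) i) ∑∑≤1) 1≤hij 1≤hi′j′

∑-δ : ∀ {n} (a : Fin n) → ∑[ i < n ] 𝟙 (does (i ≟ a)) ≡ 1
∑-δ {suc n} 0F      = cong suc (sum-replicate-zero n)
∑-δ {suc n} (suc a) = ∑-δ a

∑∑-δ : ∀ {n} (a b : Fin n) → ∑[ i < n ] ∑[ j < n ] 𝟙 (does (i ≟ a) ∧ does (j ≟ b)) ≡ 1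
∑∑-δ {n} a b = trans (sum-cong-≗ row) (∑-δ a)
  where
  row : ∀ i → ∑[ j < n ] 𝟙 (does (i ≟ a) ∧ does (j ≟ b)) ≡ 𝟙 (does (i ≟ a))
  row i with does (i ≟ a)
  ... | true  = ∑-δ b
  ... | false = sum-replicate-zero n

sum-map-tabulate : ∀ {m n} (g : Fin n → ℕ) (h : Fin m → Fin n) →
  sum (map g (tabulate h)) ≡ ∑[ i < m ] g (h i)
sum-map-tabulate {zero}  g h = refl
sum-map-tabulate {suc m} g h = cong (g (h 0F) +_) (sum-map-tabulate g (h ∘ suc))

sum-allFin : ∀ n (g : Fin n → ℕ) → sum (map g (allFin n)) ≡ ∑[ i < n ] g i
sum-allFin n g = sum-map-tabulate g id

sum-cartesianProduct : ∀ {A B : Set} (F : A × B → ℕ) xs ys →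
  sum (map F (cartesianProduct xs ys)) ≡ sum (map (λ x → sum (map (λ y → F (x , y)) ys)) xs)
sum-cartesianProduct F []       ys = refl
sum-cartesianProduct F (x ∷ xs) ys = begin
  sum (map F (map (x ,_) ys ++ cartesianProduct xs ys))
    ≡⟨ cong sum (map-++ F (map (x ,_) ys) (cartesianProduct xs ys)) ⟩
  sum (map F (map (x ,_) ys) ++ map F (cartesianProduct xs ys))
    ≡⟨ sum-++ (map F (map (x ,_) ys)) _ ⟩
  sum (map F (map (x ,_) ys)) + sum (map F (cartesianProduct xs ys))
    ≡⟨ cong₂ _+_ (cong sum (≡.sym (map-∘ ys))) (sum-cartesianProduct F xs ys) ⟩
  sum (map (λ y → F (x , y)) ys) + sum (map (λ x → sum (map (λ y → F (x , y)) ys)) xs) ∎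
  where open ≡.≡-Reasoning

choose2-suc : ∀ n → choose2 (suc n) ≡ n + choose2 n
choose2-suc n = begin
  suc n * n / 2                ≡⟨ cong (_/ 2) (expand n) ⟩
  (n * 2 + n * (n ∸ 1)) / 2    ≡⟨ +-distrib-/-∣ˡ (n * (n ∸ 1)) (divides n refl) ⟩
  n * 2 / 2 + choose2 n        ≡⟨ cong (_+ choose2 n) (m*n/n≡m n 2) ⟩
  n + choose2 n                ∎
  where
  open ≡.≡-Reasoning
  expand : ∀ n → suc n * n ≡ n * 2 + n * (n ∸ 1)
  expand zero    = refl
  expand (suc n) = ring n
    where
    ring : ∀ m → suc (suc m) * suc m ≡ suc m * 2 + suc m * m
    ring = solve-∀

n≤choose2 : ∀ m → 3 + m ≤ choose2 (3 + m)
n≤choose2 m = begin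
  3 + m                                ≡⟨ +-comm 1 (2 + m) ⟩
  2 + m + 1                            ≤⟨ +-monoʳ-≤ (2 + m) (s≤s z≤n) ⟩
  2 + m + (1 + m + choose2 (1 + m))    ≡⟨ cong (2 + m +_) (≡.sym (choose2-suc (1 + m))) ⟩
  2 + m + choose2 (2 + m)              ≡⟨ ≡.sym (choose2-suc (2 + m)) ⟩
  choose2 (3 + m)                      ∎
  where open ≤-Reasoning

-- `does` rather than the `⌊_⌋` of `edgeCount`: only `does` computes through the `map′` in
-- `_<?_` and `_≟_`, so that `lt (suc i) (suc j)` reduces to `lt i j` in the recursions over `Fin`.
lt : ∀ {n} → Fin n → Fin n → Bool
lt i j = does (toℕ i <? toℕ j)

∑∑-lt : ∀ n → ∑[ i < n ] ∑[ j < n ] 𝟙 (lt i j) ≡ choose2 n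
∑∑-lt zero    = refl
∑∑-lt (suc n) = trans (cong₂ _+_ (∑-ones n) (∑∑-lt n)) (≡.sym (choose2-suc n))

nonEdge : ∀ {n} → Graph n → Fin n → Fin n → ℕ
nonEdge G i j = 𝟙 (lt i j ∧ not (adj G i j))

nonEdgeCount : ∀ {n} → Graph n → ℕ
nonEdgeCount {n} G = ∑[ i < n ] ∑[ j < n ] nonEdge G i j

edgeCount≡∑∑ : ∀ {n} (G : Graph n) → edgeCount G ≡ ∑[ i < n ] ∑[ j < n ] 𝟙 (lt i j ∧ adj G i j)
edgeCount≡∑∑ {n} G = begin
  edgeCount G
    ≡⟨ sum-cartesianProduct _ (allFin n) (allFin n) ⟩
  sum (map (λ i → sum (map (λ j → 𝟙 (counted i j)) (allFin n))) (allFin n))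
    ≡⟨ sum-allFin n _ ⟩
  ∑[ i < n ] sum (map (λ j → 𝟙 (counted i j)) (allFin n))
    ≡⟨ sum-cong-≗ {n} (λ i → sum-allFin n _) ⟩
  ∑[ i < n ] ∑[ j < n ] 𝟙 (counted i j)
    ≡⟨ sum-cong-≗ (λ i → sum-cong-≗ λ j →
         cong (λ b → 𝟙 (b ∧ adj G i j)) (isYes≗does (toℕ i <? toℕ j))) ⟩
  ∑[ i < n ] ∑[ j < n ] 𝟙 (lt i j ∧ adj G i j) ∎
  where
  open ≡.≡-Reasoning
  counted : Fin n → Fin n → Bool
  counted i j = isYes (toℕ i <? toℕ j) ∧ adj G i j

edgeCount+nonEdgeCount : ∀ {n} (G : Graph n) → edgeCount G + nonEdgeCount G ≡ choose2 n
edgeCount+nonEdgeCount {n} G = begin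
  edgeCount G + nonEdgeCount G
    ≡⟨ cong (_+ nonEdgeCount G) (edgeCount≡∑∑ G) ⟩
  ∑[ i < n ] ∑[ j < n ] 𝟙 (lt i j ∧ adj G i j) + nonEdgeCount G
    ≡⟨ ∑∑-distrib-+ (λ i j → 𝟙 (lt i j ∧ adj G i j)) (nonEdge G) ⟨
  ∑[ i < n ] ∑[ j < n ] (𝟙 (lt i j ∧ adj G i j) + nonEdge G i j)
    ≡⟨ sum-cong-≗ (λ i → sum-cong-≗ (λ j → 𝟙-∧-split (lt i j) (adj G i j))) ⟩
  ∑[ i < n ] ∑[ j < n ] 𝟙 (lt i j)
    ≡⟨ ∑∑-lt n ⟩
  choose2 n ∎
  where open ≡.≡-Reasoning

edgeCount≥⇒nonEdgeCount≤ : ∀ {n t} (G : Graph n) → choose2 n ∸ t ≤ edgeCount G → nonEdgeCount G ≤ t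
edgeCount≥⇒nonEdgeCount≤ {n} {t} G edges = +-cancelˡ-≤ (edgeCount G) _ _ (begin
  edgeCount G + nonEdgeCount G  ≡⟨ edgeCount+nonEdgeCount G ⟩
  choose2 n                     ≤⟨ m≤n+m∸n (choose2 n) t ⟩
  t + (choose2 n ∸ t)           ≤⟨ +-monoʳ-≤ t edges ⟩
  t + edgeCount G               ≡⟨ +-comm t (edgeCount G) ⟩
  edgeCount G + t               ∎)
  where open ≤-Reasoning

nonEdgeCount≤⇒edgeCount≥ : ∀ {n t} (G : Graph n) → nonEdgeCount G ≤ t → choose2 n ∸ t ≤ edgeCount G
nonEdgeCount≤⇒edgeCount≥ {n} {t} G nonEdges = begin
  choose2 n ∸ t                                ≤⟨ ∸-monoʳ-≤ (choose2 n) nonEdges ⟩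
  choose2 n ∸ nonEdgeCount G                   ≡⟨ cong (_∸ nonEdgeCount G) (edgeCount+nonEdgeCount G) ⟨
  edgeCount G + nonEdgeCount G ∸ nonEdgeCount G ≡⟨ m+n∸n≡m (edgeCount G) (nonEdgeCount G) ⟩
  edgeCount G                                  ∎
  where open ≤-Reasoning

Complete : ∀ {n} → Graph n → Set
Complete {n} G = ∀ (x y : Fin n) → x ≢ y → adj G x y ≡ true

SamePair : ∀ {n} → Fin n → Fin n → Fin n → Fin n → Set
SamePair x y x′ y′ = (x ≡ x′ × y ≡ y′) ⊎ (x ≡ y′ × y ≡ x′)

SamePair-sym : ∀ {n} {x y x′ y′ : Fin n} → SamePair x y x′ y′ → SamePair x′ y′ x y
SamePair-sym (inj₁ (refl , refl)) = inj₁ (refl , refl)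
SamePair-sym (inj₂ (refl , refl)) = inj₂ (refl , refl)

SamePair-trans : ∀ {n} {x y x′ y′ x″ y″ : Fin n} →
  SamePair x y x′ y′ → SamePair x′ y′ x″ y″ → SamePair x y x″ y″
SamePair-trans (inj₁ (refl , refl)) q                    = q
SamePair-trans (inj₂ (refl , refl)) (inj₁ (refl , refl)) = inj₂ (refl , refl)
SamePair-trans (inj₂ (refl , refl)) (inj₂ (refl , refl)) = inj₁ (refl , refl)

nonEdge≡1 : ∀ {n} (G : Graph n) {a b} → toℕ a < toℕ b → adj G a b ≡ false → nonEdge G a b ≡ 1
nonEdge≡1 G {a} {b} a<b ab∉E rewrite dec-true (toℕ a <? toℕ b) a<b | ab∉E = refl

nonadjacent⇒nonEdge : ∀ {n} (G : Graph n) {x y} → x ≢ y → adj G x y ≡ false →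
  ∃₂ λ a b → nonEdge G a b ≡ 1 × SamePair a b x y
nonadjacent⇒nonEdge G {x} {y} x≢y xy∉E with <-cmp (toℕ x) (toℕ y)
... | tri< x<y _ _ = x , y , nonEdge≡1 G x<y xy∉E , inj₁ (refl , refl)
... | tri≈ _ x≡y _ = contradiction (toℕ-injective x≡y) x≢y
... | tri> _ _ y<x = y , x , nonEdge≡1 G y<x (trans (Graph.sym G y x) xy∉E) , inj₂ (refl , refl)

edgeCount≥choose2⇒complete : ∀ {n} (G : Graph n) → choose2 n ≤ edgeCount G → Complete G
edgeCount≥choose2⇒complete G edges x y x≢y with adj G x y in xy
... | true  = refl
... | false with nonadjacent⇒nonEdge G x≢y xy
... | a , b , ab , _ =
  contradiction (≤-trans (≤-reflexive (≡.sym ab))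
                         (≤-trans (term≤∑∑ (nonEdge G) a b) (edgeCount≥⇒nonEdgeCount≤ {t = 0} G edges)))
                λ ()

unique-nonEdge : ∀ {n} (G : Graph n) {x y x′ y′} → choose2 n ∸ 1 ≤ edgeCount G →
  x ≢ y → adj G x y ≡ false → x′ ≢ y′ → adj G x′ y′ ≡ false → SamePair x y x′ y′
unique-nonEdge G edges x≢y xy∉E x′≢y′ x′y′∉E
  with nonadjacent⇒nonEdge G x≢y xy∉E | nonadjacent⇒nonEdge G x′≢y′ x′y′∉E
... | a , b , ab , ab~xy | a′ , b′ , a′b′ , a′b′~x′y′
  with ∑∑≤1-unique (nonEdge G) (edgeCount≥⇒nonEdgeCount≤ G edges)
                   (≤-reflexive (≡.sym ab)) (≤-reflexive (≡.sym a′b′))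
... | refl , refl = SamePair-trans (SamePair-sym ab~xy) a′b′~x′y′

complete⊎nonEdge : ∀ {n} (G : Graph n) → Complete G ⊎ ∃₂ λ x y → x ≢ y × adj G x y ≡ false
complete⊎nonEdge G with any? (λ x → any? (λ y → ¬? (x ≟ y) ×-dec (adj G x y ≟ᵇ false)))
... | yes (x , y , x≢y , xy∉E) = inj₂ (x , y , x≢y , xy∉E)
... | no ∄nonEdge = inj₁ λ x y x≢y → ¬-not λ xy∉E → ∄nonEdge (x , y , x≢y , xy∉E)

allBut : ∀ {n} → Fin n → Fin n → Fin n → Bool
allBut x y z = not (does (z ≟ x)) ∧ not (does (z ≟ y))

allBut-∌ˡ : ∀ {n} (x y : Fin n) → allBut x y x ≡ false
allBut-∌ˡ x y rewrite dec-true (x ≟ x) refl = refl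

allBut-∌ʳ : ∀ {n} (x y : Fin n) → allBut x y y ≡ false
allBut-∌ʳ x y rewrite dec-true (y ≟ y) refl = ∧-zeroʳ _

allBut-∈ : ∀ {n} {x y u : Fin n} → allBut x y u ≡ true → u ≢ x × u ≢ y
allBut-∈ {x = x} {y} {u} u∈ with u ≟ x | u ≟ y
allBut-∈ () | yes _ | _
allBut-∈ () | no _  | yes _
... | no u≢x | no u≢y = u≢x , u≢y

allBut-∉ : ∀ {n} {x y u : Fin n} → allBut x y u ≡ false → u ≡ x ⊎ u ≡ y
allBut-∉ {x = x} {y} {u} u∉ with u ≟ x | u ≟ y
... | yes u≡x | _       = inj₁ u≡x
... | no _    | yes u≡y = inj₂ u≡y
allBut-∉ () | no _ | no _

reach-allBut : ∀ {n} {G : Graph n} {x y z} → adj G x y ≡ false → Reach G (allBut x y) x z → z ≡ x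
reach-allBut xy∉E (here _) = refl
reach-allBut xy∉E (step r wz∈E z∉S) with reach-allBut xy∉E r | allBut-∉ z∉S
... | refl | inj₁ z≡x  = z≡x
... | refl | inj₂ refl = contradiction (trans (≡.sym wz∈E) xy∉E) λ ()

allBut-isVertexCut : ∀ {n} (G : Graph n) {x y} → x ≢ y → adj G x y ≡ false →
  IsVertexCut G (allBut x y) x y
allBut-isVertexCut G {x} {y} x≢y xy∉E =
  allBut-∌ˡ x y , allBut-∌ʳ x y , λ r → x≢y (≡.sym (reach-allBut xy∉E r))

cut-∋-commonNeighbour : ∀ {n} {G : Graph n} {S x y z} → IsVertexCut G S x y →
  adj G x z ≡ true → adj G z y ≡ true → S z ≡ true
cut-∋-commonNeighbour {S = S} {z = z} (x∉S , y∉S , x↛y) xz∈E zy∈E with S z in z∈?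
... | true  = refl
... | false = contradiction (step (step (here x∉S) xz∈E z∈?) zy∈E y∉S) x↛y

MvdAtLeast-mono : ∀ {n} {G : Graph n} {k k′} → k′ ≤ k → MvdAtLeast G k → MvdAtLeast G k′
MvdAtLeast-mono k′≤k (c , k≤c , col) = c , ≤-trans k′≤k k≤c , col

mvd≥1 : ∀ {n} (G : Graph n) → Fin n → MvdAtLeast G 1
mvd≥1 G v = 1 , ≤-refl , (λ _ → 0F) , (λ { 0F → v , refl }) ,
  λ x y x≢y xy∉E → allBut x y , allBut-isVertexCut G x≢y xy∉E , λ _ _ _ _ → refl

complete⇒mvd≥n : ∀ {n} (G : Graph n) → Complete G → MvdAtLeast G n
complete⇒mvd≥n {n} G complete = n , ≤-refl , id , (λ j → j , refl) ,
  λ x y x≢y xy∉E → contradiction (trans (≡.sym (complete x y x≢y)) xy∉E) λ ()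

separate : ∀ {n} → Fin n → Fin n → Fin n → Fin 3
separate x₀ y₀ u = if does (u ≟ x₀) then 0F else if does (u ≟ y₀) then 1F else 2F

separate-others : ∀ {n} {x₀ y₀ : Fin n} u → u ≢ x₀ × u ≢ y₀ → separate x₀ y₀ u ≡ 2F
separate-others {x₀ = x₀} {y₀} u (u≢x₀ , u≢y₀)
  rewrite dec-false (u ≟ x₀) u≢x₀ | dec-false (u ≟ y₀) u≢y₀ = refl

separate-x₀ : ∀ {n} (x₀ y₀ : Fin n) → separate x₀ y₀ x₀ ≡ 0F
separate-x₀ x₀ y₀ rewrite dec-true (x₀ ≟ x₀) refl = refl

separate-y₀ : ∀ {n} {x₀ y₀ : Fin n} → x₀ ≢ y₀ → separate x₀ y₀ y₀ ≡ 1F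
separate-y₀ {x₀ = x₀} {y₀} x₀≢y₀
  rewrite dec-false (y₀ ≟ x₀) (x₀≢y₀ ∘ ≡.sym) | dec-true (y₀ ≟ y₀) refl = refl

separate-surjective : ∀ {n} {x₀ y₀ z : Fin n} → x₀ ≢ y₀ → z ≢ x₀ × z ≢ y₀ → Surj (separate x₀ y₀)
separate-surjective {x₀ = x₀} {y₀} _ _ 0F = x₀ , separate-x₀ x₀ y₀
separate-surjective {y₀ = y₀} x₀≢y₀ _ 1F = y₀ , separate-y₀ x₀≢y₀
separate-surjective {z = z} _ z∉ 2F = z , separate-others z z∉

SamePair-avoid : ∀ {n} {x y x₀ y₀ u : Fin n} → SamePair x y x₀ y₀ → u ≢ x × u ≢ y → u ≢ x₀ × u ≢ y₀
SamePair-avoid (inj₁ (refl , refl)) u∉ = u∉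
SamePair-avoid (inj₂ (refl , refl)) (u≢x , u≢y) = u≢y , u≢x

oneNonEdge⇒mvd≥3 : ∀ {n} (G : Graph n) {x₀ y₀ z} → x₀ ≢ y₀ → z ≢ x₀ × z ≢ y₀ →
  (∀ {x y} → x ≢ y → adj G x y ≡ false → SamePair x y x₀ y₀) → MvdAtLeast G 3
oneNonEdge⇒mvd≥3 G {x₀} {y₀} x₀≢y₀ z∉ onlyNonEdge =
  3 , ≤-refl , separate x₀ y₀ , separate-surjective x₀≢y₀ z∉ ,
  λ x y x≢y xy∉E → allBut x y , allBut-isVertexCut G x≢y xy∉E ,
    λ u v u∈ v∈ → trans (separate-others u (SamePair-avoid (onlyNonEdge x≢y xy∉E) (allBut-∈ u∈)))
                        (≡.sym (separate-others v (SamePair-avoid (onlyNonEdge x≢y xy∉E) (allBut-∈ v∈))))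

vertex-avoiding : ∀ {m} (x y : Fin (3 + m)) → ∃ λ z → z ≢ x × z ≢ y
vertex-avoiding 0F            0F            = 1F , (λ ()) , (λ ())
vertex-avoiding 0F            1F            = 2F , (λ ()) , (λ ())
vertex-avoiding 0F            (suc (suc _)) = 1F , (λ ()) , (λ ())
vertex-avoiding 1F            0F            = 2F , (λ ()) , (λ ())
vertex-avoiding (suc (suc _)) 0F            = 1F , (λ ()) , (λ ())
vertex-avoiding (suc _)       (suc _)       = 0F , (λ ()) , (λ ())

edgeCount≥choose2∸1⇒mvd≥3 : ∀ {m} (G : Graph (3 + m)) →
  choose2 (3 + m) ∸ 1 ≤ edgeCount G → MvdAtLeast G 3
edgeCount≥choose2∸1⇒mvd≥3 {m} G edges with complete⊎nonEdge G
... | inj₁ complete = MvdAtLeast-mono (m≤m+n 3 m) (complete⇒mvd≥n G complete)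
... | inj₂ (x₀ , y₀ , x₀≢y₀ , x₀y₀∉E) = oneNonEdge⇒mvd≥3 G x₀≢y₀ (proj₂ (vertex-avoiding x₀ y₀))
  λ x≢y xy∉E → unique-nonEdge G edges x≢y xy∉E x₀≢y₀ x₀y₀∉E

colours≤ : ∀ {n c m} {col : Fin n → Fin c} → Surj col →
  (palette : Fin m → Fin c) → (∀ u → ∃ λ t → col u ≡ palette t) → c ≤ m
colours≤ {col = col} surj palette covered = injective⇒≤ {f = choice} choice-injective
  where
  choice : _ → _
  choice j = proj₁ (covered (proj₁ (surj j)))
  palette∘choice : ∀ j → palette (choice j) ≡ j
  palette∘choice j = trans (≡.sym (proj₂ (covered _))) (proj₂ (surj j))
  choice-injective : ∀ {i j} → choice i ≡ choice j → i ≡ j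
  choice-injective {i} {j} eq =
    trans (≡.sym (palette∘choice i)) (trans (cong palette eq) (palette∘choice j))

dominating⇒connected : ∀ {n} (G : Graph n) w → (∀ y → y ≢ w → adj G w y ≡ true) → Connected G
dominating⇒connected G w dominating x y with x ≟ w | y ≟ w
... | yes refl | yes refl = here refl
... | yes refl | no y≢w   = step (here refl) (dominating y y≢w) refl
... | no x≢w   | yes refl = step (here refl) (trans (Graph.sym G x w) (dominating x x≢w)) refl
... | no x≢w   | no y≢w   =
  step (step (here refl) (trans (Graph.sym G x w) (dominating x x≢w)) refl) (dominating y y≢w) refl

removed : ∀ {n} → List (Fin n × Fin n) → Fin n → Fin n → Bool
removed []             i j = false
removed ((a , b) ∷ ps) i j = (does (i ≟ a) ∧ does (j ≟ b)) ∨ removed ps i j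

completeMinus : ∀ {n} → List (Fin n × Fin n) → Graph n
completeMinus ps = record
  { adj    = λ i j → (lt i j ∨ lt j i) ∧ not (removed ps i j ∨ removed ps j i)
  ; sym    = λ i j → cong₂ (λ d r → d ∧ not r) (∨-comm (lt i j) (lt j i)) (∨-comm (removed ps i j) _)
  ; irrefl = λ i → cong (λ b → (b ∨ b) ∧ not (removed ps i i ∨ removed ps i i))
                         (dec-false (toℕ i <? toℕ i) (<-irrefl refl))
  }

Increasing : ∀ {n} → Fin n × Fin n → Set
Increasing (a , b) = toℕ a < toℕ b

removed-increasing : ∀ {n} {ps : List (Fin n × Fin n)} {i j} → All Increasing ps →
  removed ps i j ≡ true → toℕ i < toℕ j
removed-increasing {ps = (a , b) ∷ ps} {i} {j} (a<b ∷ increasing) ij∈ with i ≟ a | j ≟ b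
... | yes refl | yes refl = a<b
... | yes _    | no _     = removed-increasing increasing ij∈
... | no _     | _        = removed-increasing increasing ij∈

nonEdge-completeMinus : ∀ {n} {ps : List (Fin n × Fin n)} → All Increasing ps →
  ∀ i j → nonEdge (completeMinus ps) i j ≤ 𝟙 (removed ps i j)
nonEdge-completeMinus {ps = ps} increasing i j with removed ps i j
... | true  = 𝟙≤1 _
... | false with removed ps j i in ji∈
...   | true rewrite dec-false (toℕ i <? toℕ j) (<-asym (removed-increasing increasing ji∈)) = z≤n
...   | false with lt i j
...     | true  = z≤n
...     | false = z≤n

∑∑-removed≤length : ∀ {n} (ps : List (Fin n × Fin n)) →
  ∑[ i < n ] ∑[ j < n ] 𝟙 (removed ps i j) ≤ length ps
∑∑-removed≤length {n} [] =
  ≤-reflexive (trans (sum-cong-≗ {n} λ _ → sum-replicate-zero n) (sum-replicate-zero n))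
∑∑-removed≤length {n} ((a , b) ∷ ps) = begin
  ∑[ i < n ] ∑[ j < n ] 𝟙 (δab i j ∨ removed ps i j)
    ≤⟨ ∑-mono-≤ (λ i → ∑-mono-≤ (λ j → 𝟙-∨ (δab i j) _)) ⟩
  ∑[ i < n ] ∑[ j < n ] (𝟙 (δab i j) + 𝟙 (removed ps i j))
    ≡⟨ ∑∑-distrib-+ (λ i j → 𝟙 (δab i j)) _ ⟩
  ∑[ i < n ] ∑[ j < n ] 𝟙 (δab i j) + ∑[ i < n ] ∑[ j < n ] 𝟙 (removed ps i j)
    ≤⟨ +-mono-≤ (≤-reflexive (∑∑-δ a b)) (∑∑-removed≤length ps) ⟩
  1 + length ps ∎
  where
  open ≤-Reasoning
  δab = λ i j → does (i ≟ a) ∧ does (j ≟ b)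

edgeCount-completeMinus : ∀ {n} {ps : List (Fin n × Fin n)} → All Increasing ps →
  choose2 n ∸ length ps ≤ edgeCount (completeMinus ps)
edgeCount-completeMinus {ps = ps} increasing = nonEdgeCount≤⇒edgeCount≥ (completeMinus ps)
  (≤-trans (∑-mono-≤ (λ i → ∑-mono-≤ (nonEdge-completeMinus increasing i))) (∑∑-removed≤length ps))

K-e : ∀ m → Graph (3 + m)
K-e m = completeMinus ((0F , 1F) ∷ [])

K-e-connected : ∀ m → Connected (K-e m)
K-e-connected m = dominating⇒connected (K-e m) 2F λ
  { 0F _ → refl ; 1F _ → refl ; 2F 2≢2 → contradiction refl 2≢2 ; (suc (suc (suc _))) _ → refl }

K-e-edges : ∀ m → choose2 (3 + m) ∸ 1 ≤ edgeCount (K-e m)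
K-e-edges m = edgeCount-completeMinus {3 + m} (n<1+n 0 ∷ [])

K-e-mvd≤3 : ∀ {m k} → MvdAtLeast (K-e m) k → k ≤ 3
K-e-mvd≤3 (c , k≤c , col , surj , mvd) with mvd 0F 1F (λ ()) refl
... | S , cut , mono = ≤-trans k≤c (colours≤ surj palette covered)
  where
  palette : Fin 3 → Fin c
  palette = λ { 0F → col 0F ; 1F → col 1F ; 2F → col 2F }
  covered : ∀ u → ∃ λ t → col u ≡ palette t
  covered 0F            = 0F , refl
  covered 1F            = 1F , refl
  covered (suc (suc u)) =
    2F , mono _ _ (cut-∋-commonNeighbour cut refl refl) (cut-∋-commonNeighbour cut refl refl)

K-2e : ∀ m → Graph (5 + m)
K-2e m = completeMinus ((0F , 1F) ∷ (2F , 3F) ∷ [])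

K-2e-connected : ∀ m → Connected (K-2e m)
K-2e-connected m = dominating⇒connected (K-2e m) 4F λ
  { 0F _ → refl ; 1F _ → refl ; 2F _ → refl ; 3F _ → refl ; 4F 4≢4 → contradiction refl 4≢4
  ; (suc (suc (suc (suc (suc _))))) _ → refl }

K-2e-edges : ∀ m → choose2 (5 + m) ∸ 2 ≤ edgeCount (K-2e m)
K-2e-edges m = edgeCount-completeMinus {5 + m} (n<1+n 0 ∷ n<1+n 2 ∷ [])

K-2e-mvd≤1 : ∀ {m k} → MvdAtLeast (K-2e m) k → k ≤ 1
K-2e-mvd≤1 (c , k≤c , col , surj , mvd) with mvd 0F 1F (λ ()) refl | mvd 2F 3F (λ ()) refl
... | S , cut , mono | S′ , cut′ , mono′ = ≤-trans k≤c (colours≤ surj (λ _ → col 4F) covered)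
  where
  -- Split on u so that adjacency to 0F and 1F computes (`removed` compares u with 2F and 3F).
  S∋ : ∀ u → S (suc (suc u)) ≡ true
  S∋ 0F                  = cut-∋-commonNeighbour cut refl refl
  S∋ 1F                  = cut-∋-commonNeighbour cut refl refl
  S∋ 2F                  = cut-∋-commonNeighbour cut refl refl
  S∋ (suc (suc (suc _))) = cut-∋-commonNeighbour cut refl refl
  covered : ∀ u → ∃ λ (t : Fin 1) → col u ≡ col 4F
  covered 0F            =
    0F , mono′ _ _ (cut-∋-commonNeighbour cut′ refl refl) (cut-∋-commonNeighbour cut′ refl refl)
  covered 1F            =
    0F , mono′ _ _ (cut-∋-commonNeighbour cut′ refl refl) (cut-∋-commonNeighbour cut′ refl refl)
  covered (suc (suc u)) = 0F , mono _ _ (S∋ u) (S∋ 2F)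

threshold-lowerBound : ∀ {n k t m′} (G : Graph n) → Connected G → choose2 n ∸ suc t ≤ edgeCount G →
  ¬ MvdAtLeast G k → EdgeForcesMvd n k m′ → choose2 n ∸ t ≤ m′
threshold-lowerBound {n} {t = t} G connected edges ¬mvd forces = ≮⇒≥ λ m′<C∸t →
  ¬mvd (forces G connected
    (≤-trans (<⇒≤pred m′<C∸t) (≤-trans (≤-reflexive (pred[m∸n]≡m∸[1+n] (choose2 n) t)) edges)))

theorem1p4 : ∀ (n k : ℕ) → 5 ≤ n → 1 ≤ k → k ≤ n →
    (k ≡ 1 → IsFv n k (n ∸ 1)) ×
    (2 ≤ k → k ≤ 3 → IsFv n k (choose2 n ∸ 1)) ×
    (4 ≤ k → IsFv n k (choose2 n))
theorem1p4 .(5 + m) k (s≤s (s≤s (s≤s (s≤s (s≤s {n = m} z≤n))))) _ k≤n =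
  (λ { refl → ≤-refl , (λ G _ _ → mvd≥1 G 0F) , λ _ n∸1≤m′ _ → n∸1≤m′ }) ,
  (λ 2≤k k≤3 →
    ∸-monoˡ-≤ 1 (n≤choose2 (2 + m)) ,
    (λ G _ edges → MvdAtLeast-mono k≤3 (edgeCount≥choose2∸1⇒mvd≥3 G edges)) ,
    λ _ _ → threshold-lowerBound (K-2e m) (K-2e-connected m) (K-2e-edges m) (<⇒≱ 2≤k ∘ K-2e-mvd≤1)) ,
  λ 4≤k →
    ≤-trans (m∸n≤m (5 + m) 1) (n≤choose2 (2 + m)) ,
    (λ G _ edges → MvdAtLeast-mono k≤n (complete⇒mvd≥n G (edgeCount≥choose2⇒complete G edges))) ,
    λ _ _ → threshold-lowerBound {t = 0} (K-e (2 + m)) (K-e-connected (2 + m)) (K-e-edges (2 + m))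
                            (<⇒≱ 4≤k ∘ K-e-mvd≤3)
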